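{- Let $Q\in\mathbb{M}^{n(n-1)}$. If there exist $A,B,D,H \in \mathbb{R}^{n\times n\times n}$ such that $q_{ijk\ell} = a_{ijk} + b_{ij\ell} + d_{ik\ell} + h_{jk\ell}$ for all $i,j,k,\ell\in N$ with $i\neq j$ and $k \neq \ell$, then $Q$ is linearizable.
   Context: $N = \{1,\dots,n\}$; $E = \{(i,j): i,j\in N, i\ne j\}$ is the arc set of the complete directed graph on $N$. A tour is a directed Hamiltonian cycle, identified with its arc set; $\mathcal{T}_n$ is the set of tours. $\mathbb{M}^n$: real $n\times n$ matrices indexed by $N$; $\mathbb{M}^{n(n-1)}$: real matrices with rows and columns indexed by $E$, entry in row $(i,j)$, column $(k,\ell)$ written $q_{ijk\ell}$. $Q[\tau] := \sum_{(e,f)\in\tau\times\tau} q_{ef}$, $C(\tau) := \sum_{(i,j)\in\tau} c_{ij}$. $Q$ is linearizable if some $C\in\mathbb{M}^n$ satisfies $Q[\tau] = C(\tau)$ for all $\tau\in\mathcal{T}_n$. -}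

module Defs where

open import Level using (Level; _⊔_)
open import Algebra.Bundles using (CommutativeRing)
open import Data.Nat.Base using (ℕ)
open import Data.Fin.Base using (Fin)
open import Data.Product.Base using (_×_; ∃)
open import Function.Base using (_∘_)
open import Relation.Binary.PropositionalEquality.Core using (_≡_; _≢_)
open import Data.Vec.Functional using (Vector)

iter : ∀ {n} → (Fin n → Fin n) → ℕ → Fin n → Fin n
iter σ ℕ.zero    i = i
iter σ (ℕ.suc k) i = σ (iter σ k i)

-- A tour (directed Hamiltonian cycle on N = Fin n) is given by its
-- successor function σ: its arc set is {(i , σ i) : i ∈ N}.
-- σ has no fixed points (arcs lie in E) and every node is reachable from
-- every node (a single cycle through all nodes).
IsTour : (n : ℕ) → (Fin n → Fin n) → Set
IsTour n σ = (∀ i → σ i ≢ i) × (∀ i j → ∃ λ k → iter σ k i ≡ j)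

module _ {c ℓ : Level} (R : CommutativeRing c ℓ) where
  open CommutativeRing R

  Σ[_] : ∀ {n} → Vector Carrier n → Carrier
  Σ[_] {ℕ.zero}  v = 0#
  Σ[_] {ℕ.suc n} v = v Fin.zero + Σ[_] (v ∘ Fin.suc)

  -- Q ∈ M^{n(n-1)}: q i j k l is the entry in row (i,j), column (k,l);
  -- only entries with i ≢ j and k ≢ l are ever used.
  QuadMatrix : ℕ → Set c
  QuadMatrix n = Fin n → Fin n → Fin n → Fin n → Carrier

  QVal : ∀ {n} → QuadMatrix n → (Fin n → Fin n) → Carrier
  QVal q σ = Σ[ (λ i → Σ[ (λ k → q i (σ i) k (σ k)) ] ) ]

  CVal : ∀ {n} → (Fin n → Fin n → Carrier) → (Fin n → Fin n) → Carrier
  CVal C σ = Σ[ (λ i → C i (σ i)) ]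

  Linearizable : ∀ {n} → QuadMatrix n → Set (c ⊔ ℓ)
  Linearizable {n} q =
    ∃ λ (C : Fin n → Fin n → Carrier) →
      ∀ (σ : Fin n → Fin n) → IsTour n σ → QVal q σ ≈ CVal C σ

module Submission where

-- Let σ be the successor function of a tour.  Since σ has no
-- fixed points, q(i,σi,k,σk) = a(i,σi,k) + b(i,σi,σk) + d(i,k,σk) + h(σi,k,σk),
-- and after summing over i and k each family collapses to a sum along σ:
--   Σᵢ Σₖ a(i,σi,k)  = Σᵢ A(i,σi),  A(i,j) = Σₖ a(i,j,k);
--   Σᵢ Σₖ b(i,σi,σk) = Σᵢ B(i,σi),  B(i,j) = Σₗ b(i,j,l)  (reindex k ↦ σk);
--   Σᵢ Σₖ d(i,k,σk)  = Σₖ D(k,σk),  D(k,l) = Σₘ d(m,k,l)  (exchange sums);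
--   Σᵢ Σₖ h(σi,k,σk) = Σₖ H(k,σk),  H(k,l) = Σₘ h(m,k,l)  (exchange, reindex).
-- Hence C = A + B + D + H linearizes q.

open import Defs
open import Level using (Level)
open import Algebra.Bundles using (CommutativeRing)
open import Data.Nat.Base using (ℕ; zero; suc)
open import Data.Nat.Properties using (1+n≰n)
open import Data.Fin.Base using (Fin; punchOut)
open import Data.Fin.Properties using (any?; _≟_; punchOut-injective; injective⇒≤)
open import Data.Fin.Permutation using (Permutation; permutation; _⟨$⟩ʳ_)
open import Data.Product.Base using (_,_; proj₁; proj₂; ∃)
open import Function.Base using (_∘_)
open import Function.Definitions using (Injective)
open import Relation.Binary.PropositionalEquality
  using (_≡_; _≢_; refl; sym; trans; cong; module ≡-Reasoning)
open import Relation.Nullary using (yes; no)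
open import Relation.Nullary.Negation using (contradiction)
import Algebra.Properties.CommutativeMonoid.Sum as CommutativeMonoidSum
import Relation.Binary.Reasoning.Setoid as SetoidReasoning

-- Pigeonhole: an injective endofunction of a finite set misses no element,
-- since otherwise it would inject Fin (1 + m) into Fin m.
injective⇒surjective : ∀ {n} {f : Fin n → Fin n} →
                       Injective _≡_ _≡_ f → ∀ x → ∃ λ y → f y ≡ x
injective⇒surjective {zero}  _     ()
injective⇒surjective {suc m} {f} f-inj x with any? (λ y → f y ≟ x)
... | yes hit = hit
... | no miss = contradiction (injective⇒≤ punched-inj) 1+n≰n
  where
  avoids : ∀ y → x ≢ f y
  avoids y x≡fy = miss (y , sym x≡fy)

  punched : Fin (suc m) → Fin m
  punched y = punchOut (avoids y)

  punched-inj : Injective _≡_ _≡_ punched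
  punched-inj {y} {z} eq = f-inj (punchOut-injective (avoids y) (avoids z) eq)

-- An endofunction of a finite set with a right inverse is a permutation:
-- the right inverse is injective, hence surjective, hence also a left inverse.
section⇒permutation : ∀ {n} (σ g : Fin n → Fin n) →
                      (∀ j → σ (g j) ≡ j) → Permutation n n
section⇒permutation σ g σ∘g = permutation σ g σ∘g g∘σ
  where
  g-inj : Injective _≡_ _≡_ g
  g-inj {j} {j′} eq = trans (sym (σ∘g j)) (trans (cong σ eq) (σ∘g j′))

  g∘σ : ∀ x → g (σ x) ≡ x
  g∘σ x with y , gy≡x ← injective⇒surjective g-inj x = begin
    g (σ x)       ≡⟨ cong (g ∘ σ) (sym gy≡x) ⟩
    g (σ (g y))   ≡⟨ cong g (σ∘g y) ⟩
    g y           ≡⟨ gy≡x ⟩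
    x             ∎
    where open ≡-Reasoning

-- Every node j of a tour has a predecessor: follow the tour from σ j back to j.
predecessor : ∀ {n} (σ : Fin n → Fin n) →
              (∀ i j → ∃ λ k → iter σ k i ≡ j) → ∀ j → ∃ λ i → σ i ≡ j
predecessor σ reach j with reach (σ j) j
... | zero  , σj≡j = j , σj≡j
... | suc k , eq   = iter σ k (σ j) , eq

tour⇒permutation : ∀ {n} (σ : Fin n → Fin n) → IsTour n σ → Permutation n n
tour⇒permutation σ (_ , reach) =
  section⇒permutation σ (proj₁ ∘ pre) (proj₂ ∘ pre)
  where
  pre : ∀ j → ∃ λ i → σ i ≡ j
  pre = predecessor σ reach

module Summation {c ℓ : Level} (R : CommutativeRing c ℓ) where
  open CommutativeRing R hiding (refl; sym; trans)
  open CommutativeRing R using () renaming (sym to ≈-sym; trans to ≈-trans)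
  open CommutativeMonoidSum +-commutativeMonoid
    using (sum; sum-cong-≋; sum-cong-≗; ∑-distrib-+; ∑-comm; sum-permute)
  open SetoidReasoning setoid

  Σ≡sum : ∀ {n} (v : Fin n → Carrier) → Σ[_] R v ≡ sum v
  Σ≡sum {zero}  v = refl
  Σ≡sum {suc n} v = cong (v Fin.zero +_) (Σ≡sum (v ∘ Fin.suc))

  QVal≡double-sum : ∀ {n} (q : QuadMatrix R n) (σ : Fin n → Fin n) →
    QVal R q σ ≡ sum (λ i → sum (λ k → q i (σ i) k (σ k)))
  QVal≡double-sum q σ =
    trans (Σ≡sum (λ i → Σ[_] R (λ k → q i (σ i) k (σ k))))
          (sum-cong-≗ (λ i → Σ≡sum (λ k → q i (σ i) k (σ k))))

  sum-reindex : ∀ {n} (π : Permutation n n) (f : Fin n → Carrier) →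
                sum (λ k → f (π ⟨$⟩ʳ k)) ≈ sum f
  sum-reindex π f = ≈-sym (sum-permute f π)

  sum-distrib-+₄ : ∀ {n} (f g k l : Fin n → Carrier) →
    sum (λ i → ((f i + g i) + k i) + l i) ≈ ((sum f + sum g) + sum k) + sum l
  sum-distrib-+₄ f g k l = begin
    sum (λ i → ((f i + g i) + k i) + l i)     ≈⟨ ∑-distrib-+ _ l ⟩
    sum (λ i → (f i + g i) + k i) + sum l     ≈⟨ +-congʳ (∑-distrib-+ _ k) ⟩
    (sum (λ i → f i + g i) + sum k) + sum l   ≈⟨ +-congʳ (+-congʳ (∑-distrib-+ f g)) ⟩
    ((sum f + sum g) + sum k) + sum l         ∎

  module _ {n : ℕ} (π : Permutation n n) (f : Fin n → Fin n → Fin n → Carrier) where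
    private
      σ : Fin n → Fin n
      σ = π ⟨$⟩ʳ_

    collapse-last : sum (λ i → sum (λ k → f i (σ i) (σ k)))
                  ≈ sum (λ i → sum (λ l → f i (σ i) l))
    collapse-last = sum-cong-≋ (λ i → sum-reindex π (f i (σ i)))

    collapse-first : sum (λ i → sum (λ k → f i k (σ k)))
                   ≈ sum (λ k → sum (λ m → f m k (σ k)))
    collapse-first = ∑-comm (λ i k → f i k (σ k))

    collapse-successor : sum (λ i → sum (λ k → f (σ i) k (σ k)))
                       ≈ sum (λ k → sum (λ m → f m k (σ k)))
    collapse-successor = ≈-trans (∑-comm (λ i k → f (σ i) k (σ k)))
      (sum-cong-≋ (λ k → sum-reindex π (λ m → f m k (σ k))))

  linearization : ∀ {n} (a b d h : Fin n → Fin n → Fin n → Carrier) →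
                  Fin n → Fin n → Carrier
  linearization a b d h i j =
    ((sum (λ k → a i j k) + sum (λ l → b i j l)) + sum (λ m → d m i j))
      + sum (λ m → h m i j)

  decomposed-sum : ∀ {n} (π : Permutation n n) (a b d h : Fin n → Fin n → Fin n → Carrier) →
    let σ = π ⟨$⟩ʳ_ in
    sum (λ i → sum (λ k → ((a i (σ i) k + b i (σ i) (σ k)) + d i k (σ k)) + h (σ i) k (σ k)))
      ≈ sum (λ i → linearization a b d h i (σ i))
  decomposed-sum π a b d h = begin
    sum (λ i → sum (λ k → ((a i (σ i) k + b i (σ i) (σ k)) + d i k (σ k)) + h (σ i) k (σ k)))
      ≈⟨ sum-cong-≋ (λ i → sum-distrib-+₄ (λ k → a i (σ i) k) (λ k → b i (σ i) (σ k))
                                          (λ k → d i k (σ k)) (λ k → h (σ i) k (σ k))) ⟩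
    sum (λ i → ((ΣA i + ΣB i) + ΣD i) + ΣH i)
      ≈⟨ sum-distrib-+₄ ΣA ΣB ΣD ΣH ⟩
    ((sum ΣA + sum ΣB) + sum ΣD) + sum ΣH
      ≈⟨ +-cong (+-cong (+-congˡ (collapse-last π b)) (collapse-first π d))
                (collapse-successor π h) ⟩
    ((sum (λ i → sum (λ k → a i (σ i) k)) + sum (λ i → sum (λ l → b i (σ i) l)))
      + sum (λ k → sum (λ m → d m k (σ k)))) + sum (λ k → sum (λ m → h m k (σ k)))
      ≈⟨ ≈-sym (sum-distrib-+₄ (λ i → sum (λ k → a i (σ i) k)) (λ i → sum (λ l → b i (σ i) l))
                                (λ k → sum (λ m → d m k (σ k))) (λ k → sum (λ m → h m k (σ k)))) ⟩
    sum (λ i → linearization a b d h i (σ i)) ∎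
    where
    σ : Fin _ → Fin _
    σ = π ⟨$⟩ʳ_
    ΣA ΣB ΣD ΣH : Fin _ → Carrier
    ΣA i = sum (λ k → a i (σ i) k)
    ΣB i = sum (λ k → b i (σ i) (σ k))
    ΣD i = sum (λ k → d i k (σ k))
    ΣH i = sum (λ k → h (σ i) k (σ k))

  quadratic-value : ∀ {n} (q : QuadMatrix R n) (a b d h : Fin n → Fin n → Fin n → Carrier) →
    (∀ i j k l → i ≢ j → k ≢ l → q i j k l ≈ ((a i j k + b i j l) + d i k l) + h j k l) →
    (π : Permutation n n) → (∀ i → π ⟨$⟩ʳ i ≢ i) →
    QVal R q (π ⟨$⟩ʳ_) ≈ CVal R (linearization a b d h) (π ⟨$⟩ʳ_)
  quadratic-value q a b d h split π no-fixed = begin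
    QVal R q σ
      ≡⟨ QVal≡double-sum q σ ⟩
    sum (λ i → sum (λ k → q i (σ i) k (σ k)))
      ≈⟨ sum-cong-≋ (λ i → sum-cong-≋ (λ k →
           split i (σ i) k (σ k) (no-fixed i ∘ sym) (no-fixed k ∘ sym))) ⟩
    sum (λ i → sum (λ k → ((a i (σ i) k + b i (σ i) (σ k)) + d i k (σ k)) + h (σ i) k (σ k)))
      ≈⟨ decomposed-sum π a b d h ⟩
    sum (λ i → linearization a b d h i (σ i))
      ≡⟨ sym (Σ≡sum (λ i → linearization a b d h i (σ i))) ⟩
    CVal R (linearization a b d h) σ ∎
    where
    σ : Fin _ → Fin _
    σ = π ⟨$⟩ʳ_

lemma10 : {c ℓ : Level} (R : CommutativeRing c ℓ) (n : ℕ) (q : QuadMatrix R n)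
          (a b d h : Fin n → Fin n → Fin n → CommutativeRing.Carrier R) →
          (∀ i j k l → i ≢ j → k ≢ l →
            CommutativeRing._≈_ R (q i j k l)
              (CommutativeRing._+_ R (CommutativeRing._+_ R (CommutativeRing._+_ R (a i j k) (b i j l)) (d i k l)) (h j k l))) →
          Linearizable R q
lemma10 R n q a b d h split =
  linearization a b d h , λ σ tour@(no-fixed , _) →
    quadratic-value q a b d h split (tour⇒permutation σ tour) no-fixed
  where open Summation R
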